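{- Let $G,H$ be three-player impartial games with $\mathbf O\notin o(G)$ and $\mathbf O\notin o(H)$. Then $\mathbf P\notin o(G+H)$.
   Context: All games are short impartial games (identified with the finite set of their options, no infinite runs); $G+H$ is the disjunctive sum. Three players move in turn; under normal play the player unable to move on their turn is the unique loser. The outcome $o(G)\subseteq\{\mathbf N,\mathbf O,\mathbf P\}$ (Next, Other, Previous) is defined recursively: $\mathbf N\in o(G)$ iff some option $G'$ has $\mathbf P\in o(G')$; $\mathbf O\in o(G)$ iff every option $G'$ has $\mathbf N\in o(G')$; $\mathbf P\in o(G)$ iff every option $G'$ has $\mathbf O\in o(G')$. -}

module Defs where

open import Data.List using (List; []; _∷_; _++_)
open import Data.Empty using (⊥)
open import Data.Unit using (⊤)
open import Data.Product using (_×_)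
open import Data.Sum using (_⊎_)

-- A short impartial game, identified with its finite list of options.
data Game : Set where
  mk : List Game → Game

mutual
  _⊕_ : Game → Game → Game
  mk gs ⊕ mk hs = mk (leftOpts gs (mk hs) ++ rightOpts (mk gs) hs)

  leftOpts : List Game → Game → List Game
  leftOpts [] h = []
  leftOpts (g ∷ gs) h = (g ⊕ h) ∷ leftOpts gs h

  rightOpts : Game → List Game → List Game
  rightOpts g [] = []
  rightOpts g (h ∷ hs) = (g ⊕ h) ∷ rightOpts g hs

mutual
  inN : Game → Set
  inN (mk gs) = someP gs

  inO : Game → Set
  inO (mk gs) = allN gs

  inP : Game → Set
  inP (mk gs) = allO gs

  someP : List Game → Set
  someP [] = ⊥
  someP (g ∷ gs) = inP g ⊎ someP gs

  allN : List Game → Set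
  allN [] = ⊤
  allN (g ∷ gs) = inN g × allN gs

  allO : List Game → Set
  allO [] = ⊤
  allO (g ∷ gs) = inO g × allO gs

module Submission where

-- Non-membership in an outcome class is a negative statement, but it
-- has positive evidence:  N ∉ o(G) iff every option lies outside P,
-- O ∉ o(G) iff some option lies outside N, and P ∉ o(G) iff some option lies
-- outside O.
--
-- The combinatorial heart is a joint induction on the evidence for a sum:
--   N ∉ o(A), N ∉ o(B)  ⟹  N ∉ o(A+B),
--   P ∉ o(A), N ∉ o(B)  ⟹  P ∉ o(A+B) and P ∉ o(B+A),
--   O ∉ o(A), N ∉ o(B)  ⟹  O ∉ o(A+B) and O ∉ o(B+A).
-- The theorem follows: if A' is an option of A with N ∉ o(A') and O ∉ o(B),
-- then O ∉ o(A'+B), so A+B has an option outside O, i.e. P ∉ o(A+B).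

open import Defs
open import Data.List using (List; []; _∷_; _++_; map)
open import Data.List.Membership.Propositional using (_∈_)
open import Data.List.Membership.Propositional.Properties
  using (∈-map⁺; ∈-map⁻; ∈-++⁺ˡ; ∈-++⁺ʳ; ∈-++⁻)
open import Data.List.Relation.Unary.Any using (here; there)
open import Data.Product using (Σ; _×_; _,_; proj₁; proj₂)
open import Data.Sum using (_⊎_; inj₁; inj₂)
open import Data.Unit using (tt)
open import Data.Empty using (⊥-elim)
open import Relation.Nullary using (¬_)
open import Relation.Binary.PropositionalEquality
  using (_≡_; refl; cong; cong₂)

options : Game → List Game
options (mk gs) = gs

leftOpts-map : ∀ gs h → leftOpts gs h ≡ map (_⊕ h) gs
leftOpts-map []       h = refl
leftOpts-map (g ∷ gs) h = cong ((g ⊕ h) ∷_) (leftOpts-map gs h)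

rightOpts-map : ∀ g hs → rightOpts g hs ≡ map (g ⊕_) hs
rightOpts-map g []       = refl
rightOpts-map g (h ∷ hs) = cong ((g ⊕ h) ∷_) (rightOpts-map g hs)

options-⊕ : ∀ A B → options (A ⊕ B) ≡ map (_⊕ B) (options A) ++ map (A ⊕_) (options B)
options-⊕ A@(mk as) B@(mk bs) = cong₂ _++_ (leftOpts-map as B) (rightOpts-map A bs)

left-option : ∀ A B {A'} → A' ∈ options A → (A' ⊕ B) ∈ options (A ⊕ B)
left-option A B A'∈ rewrite options-⊕ A B = ∈-++⁺ˡ (∈-map⁺ (_⊕ B) A'∈)

right-option : ∀ A B {B'} → B' ∈ options B → (A ⊕ B') ∈ options (A ⊕ B)
right-option A B B'∈ rewrite options-⊕ A B =
  ∈-++⁺ʳ (map (_⊕ B) (options A)) (∈-map⁺ (A ⊕_) B'∈)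

sum-option : ∀ A B {X} → X ∈ options (A ⊕ B) →
  Σ Game (λ A' → A' ∈ options A × X ≡ A' ⊕ B) ⊎
  Σ Game (λ B' → B' ∈ options B × X ≡ A ⊕ B')
sum-option A B X∈ rewrite options-⊕ A B with ∈-++⁻ (map (_⊕ B) (options A)) X∈
... | inj₁ X∈left  = inj₁ (∈-map⁻ (_⊕ B) X∈left)
... | inj₂ X∈right = inj₂ (∈-map⁻ (A ⊕_) X∈right)

mutual
  data NotN (G : Game) : Set where
    notN : (∀ {G'} → G' ∈ options G → NotP G') → NotN G

  data NotO (G : Game) : Set where
    notO : ∀ {G'} → G' ∈ options G → NotN G' → NotO G

  data NotP (G : Game) : Set where
    notP : ∀ {G'} → G' ∈ options G → NotO G' → NotP G

someP-member : ∀ gs → someP gs → Σ Game (λ g → g ∈ gs × inP g)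
someP-member (g ∷ gs) (inj₁ p) = g , here refl , p
someP-member (g ∷ gs) (inj₂ q) with someP-member gs q
... | g' , g'∈ , p = g' , there g'∈ , p

allN-member : ∀ {gs g} → allN gs → g ∈ gs → inN g
allN-member (n , _)  (here refl) = n
allN-member (_ , ns) (there g∈) = allN-member ns g∈

allO-member : ∀ {gs g} → allO gs → g ∈ gs → inO g
allO-member (o , _)  (here refl) = o
allO-member (_ , os) (there g∈) = allO-member os g∈

mutual
  notN-sound : ∀ {G} → NotN G → ¬ inN G
  notN-sound {mk gs} (notN h) p with someP-member gs p
  ... | _ , g∈ , pg = notP-sound (h g∈) pg

  notO-sound : ∀ {G} → NotO G → ¬ inO G
  notO-sound {mk _} (notO g∈ n) ns = notN-sound n (allN-member ns g∈)

  notP-sound : ∀ {G} → NotP G → ¬ inP G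
  notP-sound {mk _} (notP g∈ o) os = notO-sound o (allO-member os g∈)

mutual
  classifyN : ∀ gs → inN (mk gs) ⊎ NotN (mk gs)
  classifyN []            = inj₂ (notN λ ())
  classifyN (mk hs ∷ gs) with classifyP hs | classifyN gs
  ... | inj₁ p  | _             = inj₁ (inj₁ p)
  ... | inj₂ _  | inj₁ q        = inj₁ (inj₂ q)
  ... | inj₂ np | inj₂ (notN h) = inj₂ (notN λ { (here refl) → np ; (there g∈) → h g∈ })

  classifyO : ∀ gs → inO (mk gs) ⊎ NotO (mk gs)
  classifyO []            = inj₁ tt
  classifyO (mk hs ∷ gs) with classifyN hs | classifyO gs
  ... | inj₂ nn | _               = inj₂ (notO (here refl) nn)
  ... | inj₁ n  | inj₁ ns         = inj₁ (n , ns)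
  ... | inj₁ _  | inj₂ (notO g∈ w) = inj₂ (notO (there g∈) w)

  classifyP : ∀ gs → inP (mk gs) ⊎ NotP (mk gs)
  classifyP []            = inj₁ tt
  classifyP (mk hs ∷ gs) with classifyO hs | classifyP gs
  ... | inj₂ no | _               = inj₂ (notP (here refl) no)
  ... | inj₁ o  | inj₁ os         = inj₁ (o , os)
  ... | inj₁ _  | inj₂ (notP g∈ w) = inj₂ (notP (there g∈) w)

notO-complete : ∀ G → ¬ inO G → NotO G
notO-complete (mk gs) ¬o with classifyO gs
... | inj₁ o  = ⊥-elim (¬o o)
... | inj₂ no = no

-- The sum lemmas, by a joint induction on the evidence for the summands
-- (each recursive call descends into one summand's evidence).  An option of
-- A ⊕ B moves in one component, so N ∉ o(A ⊕ B) needs P ∉ for both kinds of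
-- option; P ∉ and O ∉ are witnessed by moving in the summand that carries
-- them, which is why both orders of the sum are produced.
mutual
  notN-⊕ : ∀ {A B} → NotN A → NotN B → NotN (A ⊕ B)
  notN-⊕ {A} {B} nA@(notN hA) nB@(notN hB) = notN option
    where
    option : ∀ {X} → X ∈ options (A ⊕ B) → NotP X
    option X∈ with sum-option A B X∈
    ... | inj₁ (_ , A'∈ , refl) = proj₁ (notP-⊕ (hA A'∈) nB)
    ... | inj₂ (_ , B'∈ , refl) = proj₂ (notP-⊕ (hB B'∈) nA)

  notP-⊕ : ∀ {A B} → NotP A → NotN B → NotP (A ⊕ B) × NotP (B ⊕ A)
  notP-⊕ {A} {B} (notP {A'} A'∈ oA') nB =
    notP (left-option A B A'∈) (proj₁ o) , notP (right-option B A A'∈) (proj₂ o)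
    where
    o : NotO (A' ⊕ B) × NotO (B ⊕ A')
    o = notO-⊕ oA' nB

  notO-⊕ : ∀ {A B} → NotO A → NotN B → NotO (A ⊕ B) × NotO (B ⊕ A)
  notO-⊕ {A} {B} (notO A'∈ nA') nB =
    notO (left-option A B A'∈) (notN-⊕ nA' nB) , notO (right-option B A A'∈) (notN-⊕ nB nA')

notP-of-notO-⊕ : ∀ {A B} → NotO A → NotO B → NotP (A ⊕ B)
notP-of-notO-⊕ {A} {B} (notO A'∈ nA') oB =
  notP (left-option A B A'∈) (proj₂ (notO-⊕ oB nA'))

mainTheorem5 : (G H : Game) → ¬ inO G → ¬ inO H → ¬ inP (G ⊕ H)
mainTheorem5 G H ¬oG ¬oH =
  notP-sound (notP-of-notO-⊕ (notO-complete G ¬oG) (notO-complete H ¬oH))
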